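{- Let $n\ge1$. The map $\mathrm{des}^{ -1}:\mathcal B_{n-1}\to\mathcal T_n$ is an order-preserving injection (with respect to inclusion on $\mathcal B_{n-1}$ and the Tamari order on $\mathcal T_n$); in particular $\mathcal B_{n-1}\cong\mathrm{des}^{ -1}(\mathcal B_{n-1})$ is a lattice isomorphism. Furthermore, $\mathrm{des}^{ -1}(\mathcal B_{n-1})=\mathcal T_{2,n}$, and for each $S\in\mathcal B_{n-1}$, $\mathrm{des}^{ -1}(S)$ is the unique minimal element, in the Tamari order, of the fiber $\{t\in\mathcal T_n:\mathrm{des}(t)=S\}$.
   Context: A binary tree is a rooted plane tree in which every node has $0$ or $2$ ordered children; $\mathcal T_n$ is the set of binary trees with $n+1$ leaves. $s\wedge t$ has left subtree $s$ and right subtree $t$; iterated $\wedge$ is read left to right. A right $1$-rotation replaces a maximal subtree $(t_0\wedge t_1)\wedge t_2$ by $t_0\wedge(t_1\wedge t_2)$; the Tamari order on $\mathcal T_n$ is: $t\le t'$ iff $t$ is obtained from $t'$ by finitely many inverse (left) $1$-rotations. $\mathcal T_{2,n}$ is the set of $t\in\mathcal T_n$ not containing $\mathrm{comb}_2^1=\mathrm{comb}_0\wedge((\mathrm{comb}_0\wedge\mathrm{comb}_0)\wedge\mathrm{comb}_0)$ as a subtree, where $\mathrm{comb}_0$ is a single node and $t$ contains $s$ if for some node $v$, $s$ is obtained from the maximal subtree rooted at $v$ by deleting all descendants of some of its nodes. Plane trees: rooted trees with linearly ordered children; nodes labelled $v_0,\dots,v_n$ in pre-order (root first, then the subtrees of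 the root recursively from left to right), multi-degree $(d_0,\dots,d_n)$ with $d_i$ the number of children of $v_i$. The bijection $\Phi$ from $\mathcal T_n$ to plane trees with $n+1$ nodes: $\Phi$(leaf) is a single node, $\Phi(s\wedge t)$ is $\Phi(s)$ with $\Phi(t)$ attached as new rightmost subtree of the root. $\mathcal B_{n-1}$ is the Boolean lattice of subsets of $\{1,\dots,n-1\}$ ordered by inclusion. For $t\in\mathcal T_n$ with $\Phi(t)$ of multi-degree $(d_0,\dots,d_n)$, $\mathrm{des}(t)=\{i\in\{1,\dots,n-1\}:d_i>0\}$. For $S\in\mathcal B_{n-1}$, $\mathrm{des}^{ -1}(S)$ is the binary tree $t$ such that $\Phi(t)$ has multi-degree with $d_0=n-|S|$, $d_i=1$ for $i\in S$, and $d_j=0$ for $j\in\{1,\dots,n\}\setminus S$. -}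

module Defs where

open import Data.Nat using (ℕ; zero; suc; _∸_; _+_; _<_)
open import Data.Bool using (Bool; true; false; if_then_else_)
open import Data.List using (List; []; _∷_; _++_; [_]; length)
open import Data.Vec using (Vec; []; _∷_; tabulate; toList)
import Data.Vec as Vec
open import Data.Fin using (Fin; toℕ)
open import Data.Fin.Subset using (Subset; ∣_∣; inside; outside)
open import Data.Product using (_×_)
open import Relation.Binary.Construct.Closure.ReflexiveTransitive using (Star)

infixr 5 _∧_

data Tree : Set where
  leaf : Tree
  _∧_  : Tree → Tree → Tree

-- number of internal nodes; t ∈ 𝒯ₙ  iff  size t ≡ n  (n+1 leaves)
size : Tree → ℕ
size leaf    = 0
size (s ∧ t) = suc (size s + size t)

data RightRot : Tree → Tree → Set where
  here  : ∀ {a b c} → RightRot ((a ∧ b) ∧ c) (a ∧ (b ∧ c))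
  left  : ∀ {a a' b} → RightRot a a' → RightRot (a ∧ b) (a' ∧ b)
  right : ∀ {a b b'} → RightRot b b' → RightRot (a ∧ b) (a ∧ b')

-- Tamari order: t ≤ t' iff t is obtained from t' by finitely many left
-- rotations, i.e. t' is reached from t by finitely many right rotations.
_≤T_ : Tree → Tree → Set
t ≤T t' = Star RightRot t t'

-- Pattern containment.  Prefix s u : s is obtained from u by deleting all
-- descendants of some nodes of u.
data Prefix : Tree → Tree → Set where
  cut  : ∀ {u} → Prefix leaf u
  node : ∀ {a b c d} → Prefix a c → Prefix b d → Prefix (a ∧ b) (c ∧ d)

data Contains : Tree → Tree → Set where
  at    : ∀ {s t} → Prefix s t → Contains t s
  inL   : ∀ {s a b} → Contains a s → Contains (a ∧ b) s
  inR   : ∀ {s a b} → Contains b s → Contains (a ∧ b) s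

comb₀ : Tree
comb₀ = leaf

comb₂¹ : Tree
comb₂¹ = comb₀ ∧ ((comb₀ ∧ comb₀) ∧ comb₀)

data PTree : Set where
  pnode : List PTree → PTree

Φ : Tree → PTree
Φ leaf = pnode []
Φ (s ∧ t) with Φ s
... | pnode cs = pnode (cs ++ [ Φ t ])

mutual
  multiDegree : PTree → List ℕ
  multiDegree (pnode cs) = length cs ∷ multiDegreeL cs

  multiDegreeL : List PTree → List ℕ
  multiDegreeL []       = []
  multiDegreeL (c ∷ cs) = multiDegree c ++ multiDegreeL cs

-- i-th entry of a list (0 if out of range)
nth : List ℕ → ℕ → ℕ
nth []       _       = 0
nth (x ∷ xs) zero    = x
nth (x ∷ xs) (suc i) = nth xs i

-- ℬ_{n-1} for n = suc m is  Subset m; the element k : Fin m encodes i = 1 + toℕ k.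
posSide : ℕ → Bool
posSide zero    = outside
posSide (suc _) = inside

des : (m : ℕ) → Tree → Subset m
des m t = tabulate (λ k → posSide (nth (multiDegree (Φ t)) (suc (toℕ k))))

desInvDegree : {m : ℕ} → Subset m → List ℕ
desInvDegree {m} S =
  (suc m ∸ ∣ S ∣) ∷ (toList (Vec.map (λ b → if b then 1 else 0) S) ++ [ 0 ])

-- Explicit construction of des⁻¹(S): Φ(des⁻¹ S) is a root whose children
-- are chains (paths); binary tree of a chain with L ≥ 1 nodes:
chain : ℕ → Tree
chain zero          = leaf
chain (suc zero)    = leaf
chain (suc (suc L)) = leaf ∧ chain (suc L)

-- acc: binary tree of root with the completed chains; cur: length of current chain
desInvGo : {k : ℕ} → Tree → ℕ → Vec Bool k → Tree
desInvGo acc cur []             = acc ∧ chain cur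
desInvGo acc cur (true  ∷ bs)   = desInvGo acc (suc cur) bs
desInvGo acc cur (false ∷ bs)   = desInvGo (acc ∧ chain cur) 1 bs

desInv : {m : ℕ} → Subset m → Tree
desInv S = desInvGo leaf 1 S

-- Read Φ t in pre-order and record, for each non-root node v₁,…,vₙ, whether it has
-- children; this word ends with false (vₙ is a leaf) and des t is the rest of it.  A
-- right rotation (a ∧ b) ∧ c ↦ a ∧ (b ∧ c) never turns a letter false, and it changes
-- the word iff b is a leaf; if b is not a leaf, its target contains comb₂¹ at that node.
-- Since words only grow, a tree below u in the fiber of u reaches u by a last rotation
-- that preserves the word, so a tree avoiding comb₂¹ is minimal in its fiber, while a
-- tree containing comb₂¹ is the target of a word-preserving rotation and is not.  The
-- trees avoiding comb₂¹ are exactly the roots carrying a sequence of chains, i.e. the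
-- trees des⁻¹ S, and enlarging S merges adjacent chains, which is done by right rotations.
module Submission where

open import Defs
open import Data.Nat using (ℕ; zero; suc; _+_; _∸_)
open import Data.Nat.Properties using (+-suc; +-comm; +-identityʳ; +-∸-assoc; suc-injective)
open import Data.Bool using (Bool; true; false; if_then_else_)
import Data.Bool as Bool
open import Data.Bool.Properties using () renaming (≤-refl to ≤ᵇ-refl; ≤-trans to ≤ᵇ-trans; ≤-antisym to ≤ᵇ-antisym; ≤-maximum to ≤ᵇ-maximum)
open import Data.List using (List; []; _∷_; _++_; [_]; _∷ʳ_; length; map; replicate)
open import Data.List.Properties using (++-assoc; ++-identityʳ; length-++; length-map; map-++; ∷-injectiveʳ; ++-cancelˡ; ++-cancelʳ)
open import Data.List.Relation.Binary.Pointwise as Pointwise using (Pointwise; []; _∷_; Pointwise-≡⇒≡; Pointwise-length)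
open import Data.Vec using ([]; _∷_; tabulate; toList; lookup; here)
import Data.Vec as Vec
open import Data.Vec.Properties using (tabulate-cong; tabulate∘lookup; lookup∘tabulate; []=⇒lookup; lookup⇒[]=)
open import Data.Fin using (Fin; toℕ)
import Data.Fin as Fin
open import Data.Fin.Subset using (Subset; _⊆_; ∣_∣; ∁)
open import Data.Fin.Subset.Properties using (drop-∷-⊆; ∣∁p∣≡n∸∣p∣; ∣p∣≤n)
open import Data.Product using (_×_; Σ; ∃-syntax; _,_)
open import Data.Sum using (_⊎_; inj₁; inj₂)
open import Data.Empty using (⊥-elim)
open import Relation.Binary.PropositionalEquality using (_≡_; _≢_; refl; sym; trans; cong; cong₂; subst; subst₂; module ≡-Reasoning)
open import Relation.Nullary using (¬_)
open import Function.Bundles using (_⇔_; mk⇔)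
open import Relation.Binary.Construct.Closure.ReflexiveTransitive using (ε; _◅_; _◅◅_)

private
  variable
    a a' b r s t u y : Tree
    k m : ℕ

≤T-congˡ : a ≤T a' → (a ∧ b) ≤T (a' ∧ b)
≤T-congˡ ε         = ε
≤T-congˡ (ρ ◅ a≤a') = left ρ ◅ ≤T-congˡ a≤a'

≤T-congʳ : ∀ a → b ≤T u → (a ∧ b) ≤T (a ∧ u)
≤T-congʳ a ε          = ε
≤T-congʳ a (ρ ◅ b≤u) = right ρ ◅ ≤T-congʳ a b≤u

≤T⇒≡⊎last-rotation : t ≤T u → t ≡ u ⊎ ∃[ y ] (t ≤T y × RightRot y u)
≤T⇒≡⊎last-rotation ε = inj₁ refl
≤T⇒≡⊎last-rotation (ρ ◅ t≤u) with ≤T⇒≡⊎last-rotation t≤u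
... | inj₁ refl             = inj₂ (_ , ε , ρ)
... | inj₂ (y , t≤y , ρ′) = inj₂ (y , ρ ◅ t≤y , ρ′)

RightRot-irrefl : ¬ RightRot t t
RightRot-irrefl (left ρ)  = RightRot-irrefl ρ
RightRot-irrefl (right ρ) = RightRot-irrefl ρ

-- The descent word: desWord t lists [dᵢ > 0] for i = 1,…,n

isNode : Tree → Bool
isNode leaf    = false
isNode (_ ∧ _) = true

desWord : Tree → List Bool
desWord leaf    = []
desWord (s ∧ u) = desWord s ++ isNode u ∷ desWord u

length-desWord : ∀ t → length (desWord t) ≡ size t
length-desWord leaf    = refl
length-desWord (s ∧ u) = begin
  length (desWord s ++ isNode u ∷ desWord u) ≡⟨ length-++ (desWord s) ⟩
  length (desWord s) + suc (length (desWord u)) ≡⟨ cong₂ (λ x y → x + suc y) (length-desWord s) (length-desWord u) ⟩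
  size s + suc (size u)                         ≡⟨ +-suc (size s) (size u) ⟩
  suc (size s + size u)                         ∎
  where open ≡-Reasoning

desWord-∷ʳ-false : ∀ s u → ∃[ w ] desWord (s ∧ u) ≡ w ∷ʳ false
desWord-∷ʳ-false s leaf      = desWord s , refl
desWord-∷ʳ-false s (u₁ ∧ u₂) with desWord-∷ʳ-false u₁ u₂
... | w , eq = desWord s ++ true ∷ w
             , trans (cong (λ v → desWord s ++ true ∷ v) eq) (sym (++-assoc (desWord s) (true ∷ w) [ false ]))

multiDegreeL-∷ʳ : ∀ cs c → multiDegreeL (cs ∷ʳ c) ≡ multiDegreeL cs ++ multiDegree c
multiDegreeL-∷ʳ []       c = ++-identityʳ (multiDegree c)
multiDegreeL-∷ʳ (c′ ∷ cs) c = trans (cong (multiDegree c′ ++_) (multiDegreeL-∷ʳ cs c))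
                                    (sym (++-assoc (multiDegree c′) _ _))

length-∷ʳ : ∀ {A : Set} (xs : List A) x → length (xs ∷ʳ x) ≡ suc (length xs)
length-∷ʳ xs x = trans (length-++ xs) (+-comm (length xs) 1)

multiDegree-Φ-∧ : ∀ s u {d ds} → multiDegree (Φ s) ≡ d ∷ ds →
                  multiDegree (Φ (s ∧ u)) ≡ suc d ∷ (ds ++ multiDegree (Φ u))
multiDegree-Φ-∧ s u eq with Φ s | eq
... | pnode cs | refl = cong₂ _∷_ (length-∷ʳ cs (Φ u)) (multiDegreeL-∷ʳ cs (Φ u))

posSide-multiDegree : ∀ t → map posSide (multiDegree (Φ t)) ≡ isNode t ∷ desWord t
posSide-multiDegree leaf    = refl
posSide-multiDegree (s ∧ u) with multiDegree (Φ s) in eq | posSide-multiDegree s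
... | d ∷ ds | signs = begin
  map posSide (multiDegree (Φ (s ∧ u)))            ≡⟨ cong (map posSide) (multiDegree-Φ-∧ s u eq) ⟩
  true ∷ map posSide (ds ++ multiDegree (Φ u))     ≡⟨ cong (true ∷_) (map-++ posSide ds _) ⟩
  true ∷ (map posSide ds ++ map posSide (multiDegree (Φ u)))
    ≡⟨ cong₂ (λ x y → true ∷ (x ++ y)) (∷-injectiveʳ signs) (posSide-multiDegree u) ⟩
  true ∷ desWord (s ∧ u)                           ∎
  where open ≡-Reasoning

length-multiDegree : ∀ t → length (multiDegree (Φ t)) ≡ suc (size t)
length-multiDegree t = begin
  length (multiDegree (Φ t))             ≡⟨ sym (length-map posSide (multiDegree (Φ t))) ⟩
  length (map posSide (multiDegree (Φ t))) ≡⟨ cong length (posSide-multiDegree t) ⟩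
  suc (length (desWord t))               ≡⟨ cong suc (length-desWord t) ⟩
  suc (size t)                           ∎
  where open ≡-Reasoning

-- out-of-range letters read as false, matching nth's default 0
bitAt : List Bool → ℕ → Bool
bitAt []       _       = false
bitAt (x ∷ xs) zero    = x
bitAt (x ∷ xs) (suc i) = bitAt xs i

posSide-nth : ∀ ds i → posSide (nth ds i) ≡ bitAt (map posSide ds) i
posSide-nth []       i       = refl
posSide-nth (d ∷ ds) zero    = refl
posSide-nth (d ∷ ds) (suc i) = posSide-nth ds i

des-bit : ∀ t (i : Fin m) → posSide (nth (multiDegree (Φ t)) (suc (toℕ i))) ≡ bitAt (desWord t) (toℕ i)
des-bit t i = trans (posSide-nth (multiDegree (Φ t)) (suc (toℕ i)))
                    (cong (λ w → bitAt w (suc (toℕ i))) (posSide-multiDegree t))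

des-desWord : ∀ t → des m t ≡ tabulate (λ i → bitAt (desWord t) (toℕ i))
des-desWord t = tabulate-cong (des-bit t)

toList-tabulate-bitAt : ∀ w x → toList (tabulate {n = length w} (λ i → bitAt (w ∷ʳ x) (toℕ i))) ≡ w
toList-tabulate-bitAt []      x = refl
toList-tabulate-bitAt (b ∷ w) x = cong (b ∷_) (toList-tabulate-bitAt w x)

desWord-des : size t ≡ suc m → desWord t ≡ toList (des m t) ∷ʳ false
desWord-des {s ∧ u} {m} sz with desWord-∷ʳ-false s u
... | w , eq
  with suc-injective (trans (sym sz) (trans (sym (length-desWord (s ∧ u))) (trans (cong length eq) (length-∷ʳ w false))))
... | refl = begin
  desWord (s ∧ u)                                              ≡⟨ eq ⟩
  w ∷ʳ false                                                   ≡⟨ cong (_∷ʳ false) (sym (toList-tabulate-bitAt w false)) ⟩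
  toList (tabulate (λ i → bitAt (w ∷ʳ false) (toℕ i))) ∷ʳ false ≡⟨ cong (λ v → toList (tabulate (λ i → bitAt v (toℕ i))) ∷ʳ false) (sym eq) ⟩
  toList (tabulate (λ i → bitAt (desWord (s ∧ u)) (toℕ i))) ∷ʳ false ≡⟨ cong (λ v → toList v ∷ʳ false) (sym (des-desWord (s ∧ u))) ⟩
  toList (des m (s ∧ u)) ∷ʳ false                              ∎
  where open ≡-Reasoning

des≡⇒desWord≡ : size t ≡ suc m → size u ≡ suc m → des m t ≡ des m u → desWord t ≡ desWord u
des≡⇒desWord≡ szt szu d =
  trans (desWord-des szt) (trans (cong (λ v → toList v ∷ʳ false) d) (sym (desWord-des szu)))

desWord≡⇒des≡ : ∀ t u → desWord t ≡ desWord u → des m t ≡ des m u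
desWord≡⇒des≡ t u w = trans (des-desWord t) (trans (cong (λ v → tabulate (λ i → bitAt v (toℕ i))) w) (sym (des-desWord u)))

-- Right rotations and the descent word

infix 4 _≤ʷ_
_≤ʷ_ : List Bool → List Bool → Set
_≤ʷ_ = Pointwise Bool._≤_

≤ʷ-refl : ∀ {w} → w ≤ʷ w
≤ʷ-refl = Pointwise.refl ≤ᵇ-refl

≤ʷ-trans : ∀ {v w x} → v ≤ʷ w → w ≤ʷ x → v ≤ʷ x
≤ʷ-trans = Pointwise.transitive ≤ᵇ-trans

≤ʷ-antisym : ∀ {v w} → v ≤ʷ w → w ≤ʷ v → v ≡ w
≤ʷ-antisym v≤w w≤v = Pointwise-≡⇒≡ (Pointwise.antisymmetric ≤ᵇ-antisym v≤w w≤v)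

bitAt-mono : ∀ {v w} → v ≤ʷ w → ∀ i → bitAt v i Bool.≤ bitAt w i
bitAt-mono []          i       = ≤ᵇ-refl
bitAt-mono (b≤c ∷ v≤w) zero    = b≤c
bitAt-mono (b≤c ∷ v≤w) (suc i) = bitAt-mono v≤w i

isNode-RightRot : RightRot t u → isNode t ≡ isNode u
isNode-RightRot here      = refl
isNode-RightRot (left ρ)  = refl
isNode-RightRot (right ρ) = refl

RightRot-desWord : RightRot t u → desWord t ≤ʷ desWord u
RightRot-desWord (here {a} {b} {c}) rewrite ++-assoc (desWord a) (isNode b ∷ desWord b) (isNode c ∷ desWord c) =
  Pointwise.++⁺ ≤ʷ-refl (≤ᵇ-maximum (isNode b) ∷ ≤ʷ-refl)
RightRot-desWord (left ρ)             = Pointwise.++⁺ (RightRot-desWord ρ) ≤ʷ-refl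
RightRot-desWord (right {a} ρ) rewrite isNode-RightRot ρ =
  Pointwise.++⁺ (≤ʷ-refl {desWord a}) (Bool.b≤b ∷ RightRot-desWord ρ)

≤T-desWord : t ≤T u → desWord t ≤ʷ desWord u
≤T-desWord ε         = ≤ʷ-refl
≤T-desWord (ρ ◅ t≤u) = ≤ʷ-trans (RightRot-desWord ρ) (≤T-desWord t≤u)

size-RightRot : RightRot t u → size t ≡ size u
size-RightRot {t} {u} ρ =
  trans (sym (length-desWord t)) (trans (Pointwise-length (RightRot-desWord ρ)) (length-desWord u))

tabulate-⊆ : {f g : Fin k → Bool} → (∀ i → f i Bool.≤ g i) → tabulate f ⊆ tabulate g
tabulate-⊆ {f = f} {g} f≤g {i} i∈f = lookup⇒[]= i (tabulate g) (trans (lookup∘tabulate g i) gi≡true)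
  where
  fi≡true : f i ≡ true
  fi≡true = trans (sym (lookup∘tabulate f i)) ([]=⇒lookup i∈f)
  gi≡true : g i ≡ true
  gi≡true = ≤ᵇ-antisym (≤ᵇ-maximum (g i)) (subst (Bool._≤ g i) fi≡true (f≤g i))

des-mono : t ≤T u → des m t ⊆ des m u
des-mono {t = t} {u} t≤u = tabulate-⊆ λ i →
  subst₂ Bool._≤_ (sym (des-bit t i)) (sym (des-bit u i)) (bitAt-mono (≤T-desWord t≤u) (toℕ i))

-- Fibers of des and the pattern comb₂¹

RightRot-desWord-≢ : RightRot y u → ¬ Contains u comb₂¹ → desWord y ≢ desWord u
RightRot-desWord-≢ (here {a} {leaf} {c}) _ eq
  with ++-cancelˡ (desWord a) _ _ (trans (sym (++-assoc (desWord a) [ false ] (isNode c ∷ desWord c))) eq)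
... | ()
RightRot-desWord-≢ (here {b = _ ∧ _}) avoids _ = avoids (at (node cut (node (node cut cut) cut)))
RightRot-desWord-≢ (left {b = b} ρ) avoids eq =
  RightRot-desWord-≢ ρ (λ c → avoids (inL c)) (++-cancelʳ (isNode b ∷ desWord b) _ _ eq)
RightRot-desWord-≢ (right {a} ρ) avoids eq =
  RightRot-desWord-≢ ρ (λ c → avoids (inR c)) (∷-injectiveʳ (++-cancelˡ (desWord a) _ _ eq))

avoids⇒minimal : ¬ Contains u comb₂¹ → t ≤T u → desWord t ≡ desWord u → t ≡ u
avoids⇒minimal avoids t≤u w with ≤T⇒≡⊎last-rotation t≤u
... | inj₁ t≡u            = t≡u
... | inj₂ (y , t≤y , ρ) = ⊥-elim (RightRot-desWord-≢ ρ avoids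
        (≤ʷ-antisym (RightRot-desWord ρ) (subst (_≤ʷ _) w (≤T-desWord t≤y))))

contains⇒left-rotation : Contains u comb₂¹ → ∃[ t ] (RightRot t u × desWord t ≡ desWord u)
contains⇒left-rotation (at (node {c = a} {d = (b ∧ c) ∧ d} cut (node (node cut cut) cut))) =
  (a ∧ (b ∧ c)) ∧ d , here , ++-assoc (desWord a) (true ∷ (desWord b ++ isNode c ∷ desWord c)) (isNode d ∷ desWord d)
contains⇒left-rotation (inL {b = b} c) with contains⇒left-rotation c
... | t , ρ , w = t ∧ b , left ρ , cong (_++ isNode b ∷ desWord b) w
contains⇒left-rotation (inR {a = a} c) with contains⇒left-rotation c
... | t , ρ , w = a ∧ t , right ρ , cong₂ (λ x v → desWord a ++ x ∷ v) (isNode-RightRot ρ) w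

-- The trees des⁻¹ S

indicator : Bool → ℕ
indicator b = if b then 1 else 0

replicate-suc-++ : ∀ {A : Set} c (x : A) xs → replicate (suc c) x ++ xs ≡ replicate c x ++ x ∷ xs
replicate-suc-++ zero    x xs = refl
replicate-suc-++ (suc c) x xs = cong (x ∷_) (replicate-suc-++ c x xs)

multiDegree-chain : ∀ c → multiDegree (Φ (chain (suc c))) ≡ replicate c 1 ++ [ 0 ]
multiDegree-chain zero    = refl
multiDegree-chain (suc c) = trans (multiDegree-Φ-∧ leaf (chain (suc c)) refl) (cong (1 ∷_) (multiDegree-chain c))

multiDegree-desInvGo : ∀ (bs : Subset k) acc c {h ds} → multiDegree (Φ acc) ≡ h ∷ ds →
  multiDegree (Φ (desInvGo acc (suc c) bs))
    ≡ suc (∣ ∁ bs ∣ + h) ∷ (ds ++ replicate c 1 ++ toList (Vec.map indicator bs) ++ [ 0 ])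
multiDegree-desInvGo [] acc c {h} {ds} eq =
  trans (multiDegree-Φ-∧ acc (chain (suc c)) eq) (cong (λ z → suc h ∷ (ds ++ z)) (multiDegree-chain c))
multiDegree-desInvGo (true ∷ bs) acc c {h} {ds} eq =
  trans (multiDegree-desInvGo bs acc (suc c) eq)
        (cong (λ z → suc (∣ ∁ bs ∣ + h) ∷ (ds ++ z)) (replicate-suc-++ c 1 _))
multiDegree-desInvGo (false ∷ bs) acc c {h} {ds} eq =
  trans (multiDegree-desInvGo bs (acc ∧ chain (suc c)) 0 eq′)
        (cong₂ (λ x y → suc x ∷ y) (+-suc ∣ ∁ bs ∣ h)
               (trans (++-assoc ds (replicate c 1 ++ [ 0 ]) _) (cong (ds ++_) (++-assoc (replicate c 1) [ 0 ] _))))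
  where
  eq′ : multiDegree (Φ (acc ∧ chain (suc c))) ≡ suc h ∷ (ds ++ replicate c 1 ++ [ 0 ])
  eq′ = trans (multiDegree-Φ-∧ acc (chain (suc c)) eq) (cong (λ z → suc h ∷ (ds ++ z)) (multiDegree-chain c))

multiDegree-desInv : (S : Subset m) → multiDegree (Φ (desInv S)) ≡ desInvDegree S
multiDegree-desInv {m} S = trans (multiDegree-desInvGo S leaf 0 refl)
  (cong (_∷ (toList (Vec.map indicator S) ++ [ 0 ])) rootDegree)
  where
  open ≡-Reasoning
  rootDegree : suc (∣ ∁ S ∣ + 0) ≡ suc m ∸ ∣ S ∣
  rootDegree = begin
    suc (∣ ∁ S ∣ + 0)    ≡⟨ cong suc (+-identityʳ ∣ ∁ S ∣) ⟩
    suc ∣ ∁ S ∣          ≡⟨ cong suc (∣∁p∣≡n∸∣p∣ S) ⟩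
    suc (m ∸ ∣ S ∣)      ≡⟨ sym (+-∸-assoc 1 (∣p∣≤n S)) ⟩
    suc m ∸ ∣ S ∣        ∎

length-indicators : (S : Subset m) → length (toList (Vec.map indicator S) ++ [ 0 ]) ≡ suc m
length-indicators []      = refl
length-indicators (b ∷ S) = cong suc (length-indicators S)

size-desInv : (S : Subset m) → size (desInv S) ≡ suc m
size-desInv S = suc-injective (begin
  suc (size (desInv S))                 ≡⟨ sym (length-multiDegree (desInv S)) ⟩
  length (multiDegree (Φ (desInv S)))   ≡⟨ cong length (multiDegree-desInv S) ⟩
  suc (length (toList (Vec.map indicator S) ++ [ 0 ])) ≡⟨ cong suc (length-indicators S) ⟩
  suc (suc _)                           ∎)
  where open ≡-Reasoning

posSide-indicators : (S : Subset m) (z : List ℕ) (i : Fin m) →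
                     posSide (nth (toList (Vec.map indicator S) ++ z) (toℕ i)) ≡ lookup S i
posSide-indicators (true ∷ S)  z Fin.zero    = refl
posSide-indicators (false ∷ S) z Fin.zero    = refl
posSide-indicators (b ∷ S)     z (Fin.suc i) = posSide-indicators S z i

des-desInv : (S : Subset m) → des m (desInv S) ≡ S
des-desInv S = trans
  (tabulate-cong λ i → trans (cong (λ ds → posSide (nth ds (suc (toℕ i)))) (multiDegree-desInv S))
                             (posSide-indicators S [ 0 ] i))
  (tabulate∘lookup S)

data IsChain : Tree → Set where
  leaf  : IsChain leaf
  leaf∧ : IsChain r → IsChain (leaf ∧ r)

chain-IsChain : ∀ c → IsChain (chain (suc c))
chain-IsChain zero    = leaf
chain-IsChain (suc c) = leaf∧ (chain-IsChain c)

IsChain-avoids : IsChain r → ¬ Contains r comb₂¹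
IsChain-avoids leaf             (at ())
IsChain-avoids (leaf∧ leaf)     (at (node _ ()))
IsChain-avoids (leaf∧ (leaf∧ _)) (at (node _ (node () _)))
IsChain-avoids (leaf∧ _)        (inL (at ()))
IsChain-avoids (leaf∧ r)        (inR c) = IsChain-avoids r c

∧-IsChain-avoids : ¬ Contains a comb₂¹ → IsChain r → ¬ Contains (a ∧ r) comb₂¹
∧-IsChain-avoids avoids leaf      (at (node _ ()))
∧-IsChain-avoids avoids (leaf∧ _) (at (node _ (node () _)))
∧-IsChain-avoids avoids _         (inL c) = avoids c
∧-IsChain-avoids avoids r         (inR c) = IsChain-avoids r c

desInvGo-avoids : ∀ (bs : Subset k) acc c → ¬ Contains acc comb₂¹ → ¬ Contains (desInvGo acc (suc c) bs) comb₂¹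
desInvGo-avoids []           acc c avoids = ∧-IsChain-avoids avoids (chain-IsChain c)
desInvGo-avoids (true ∷ bs)  acc c avoids = desInvGo-avoids bs acc (suc c) avoids
desInvGo-avoids (false ∷ bs) acc c avoids =
  desInvGo-avoids bs (acc ∧ chain (suc c)) 0 (∧-IsChain-avoids avoids (chain-IsChain c))

desInv-avoids : (S : Subset m) → ¬ Contains (desInv S) comb₂¹
desInv-avoids S = desInvGo-avoids S leaf 0 λ { (at ()) }

chain⊎contains : ∀ r → (∃[ L ] r ≡ chain (suc L)) ⊎ (∀ a → Contains (a ∧ r) comb₂¹)
chain⊎contains leaf            = inj₁ (0 , refl)
chain⊎contains ((_ ∧ _) ∧ _)   = inj₂ λ a → at (node cut (node (node cut cut) cut))
chain⊎contains (leaf ∧ r) with chain⊎contains r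
... | inj₁ (L , refl) = inj₁ (suc L , refl)
... | inj₂ contains   = inj₂ λ a → inR (contains leaf)

desInvGo-trues : ∀ acc L → desInvGo acc 1 (Vec.replicate L true) ≡ acc ∧ chain (suc L)
desInvGo-trues acc L = trans (go 1 L) (cong (λ n → acc ∧ chain n) (+-comm L 1))
  where
  go : ∀ cur L → desInvGo acc cur (Vec.replicate L true) ≡ acc ∧ chain (L + cur)
  go cur zero    = refl
  go cur (suc L) = trans (go (suc cur) L) (cong (λ n → acc ∧ chain n) (+-suc L cur))

desInvGo-++ : ∀ {j} (bs : Subset k) (cs : Subset j) acc cur →
              desInvGo acc cur (bs Vec.++ false ∷ cs) ≡ desInvGo (desInvGo acc cur bs) 1 cs
desInvGo-++ []           cs acc cur = refl
desInvGo-++ (true ∷ bs)  cs acc cur = desInvGo-++ bs cs acc (suc cur)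
desInvGo-++ (false ∷ bs) cs acc cur = desInvGo-++ bs cs (acc ∧ chain cur) 1

InImage : Tree → Set
InImage t = ∃[ k ] Σ (Subset k) λ S → desInv S ≡ t

contains⊎image : ∀ a r → Contains (a ∧ r) comb₂¹ ⊎ InImage (a ∧ r)
contains⊎image a r with chain⊎contains r
... | inj₂ contains = inj₁ (contains a)
contains⊎image leaf r | inj₁ (L , refl) = inj₂ (L , Vec.replicate L true , desInvGo-trues leaf L)
contains⊎image (a₁ ∧ a₂) r | inj₁ (L , refl) with contains⊎image a₁ a₂
... | inj₁ contains      = inj₁ (inL contains)
... | inj₂ (k , S , e)    = inj₂ (k + suc L , S Vec.++ false ∷ Vec.replicate L true ,
  trans (desInvGo-++ S _ leaf 1) (trans (desInvGo-trues (desInv S) L) (cong (_∧ chain (suc L)) e)))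

avoids⇒image : size t ≡ suc m → ¬ Contains t comb₂¹ → ∃[ S ] desInv {m} S ≡ t
avoids⇒image {leaf}  () _
avoids⇒image {a ∧ r} sz avoids with contains⊎image a r
... | inj₁ contains       = ⊥-elim (avoids contains)
... | inj₂ (k , S , e) with suc-injective (trans (sym (size-desInv S)) (trans (cong size e) sz))
...   | refl = S , e

merge-chains : ∀ c d → (chain (suc c) ∧ chain (suc d)) ≤T chain (suc c + suc d)
merge-chains zero    d = ε
merge-chains (suc c) d = here ◅ ≤T-congʳ leaf (merge-chains c d)

merge-last-chains : ∀ acc c d → ((acc ∧ chain (suc c)) ∧ chain (suc d)) ≤T (acc ∧ chain (suc d + suc c))
merge-last-chains acc c d = here ◅ ≤T-congʳ acc
  (subst (λ n → (chain (suc c) ∧ chain (suc d)) ≤T chain n) (+-comm (suc c) (suc d)) (merge-chains c d))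

desInvGo-monoˡ : ∀ (bs : Subset k) cur → a ≤T a' → desInvGo a cur bs ≤T desInvGo a' cur bs
desInvGo-monoˡ []           cur a≤a' = ≤T-congˡ a≤a'
desInvGo-monoˡ (true ∷ bs)  cur a≤a' = desInvGo-monoˡ bs (suc cur) a≤a'
desInvGo-monoˡ (false ∷ bs) cur a≤a' = desInvGo-monoˡ bs 1 (≤T-congˡ a≤a')

desInvGo-merge : ∀ (bs : Subset k) acc c d →
                 desInvGo (acc ∧ chain (suc c)) (suc d) bs ≤T desInvGo acc (suc d + suc c) bs
desInvGo-merge []           acc c d = merge-last-chains acc c d
desInvGo-merge (true ∷ bs)  acc c d = desInvGo-merge bs acc c (suc d)
desInvGo-merge (false ∷ bs) acc c d = desInvGo-monoˡ bs 1 (merge-last-chains acc c d)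

desInvGo-mono : {bs bs' : Subset k} → bs ⊆ bs' → ∀ acc c → desInvGo acc (suc c) bs ≤T desInvGo acc (suc c) bs'
desInvGo-mono {bs = []}          {[]}          _   acc c = ε
desInvGo-mono {bs = true ∷ bs}   {true ∷ bs'}  sub acc c = desInvGo-mono (drop-∷-⊆ sub) acc (suc c)
desInvGo-mono {bs = false ∷ bs}  {false ∷ bs'} sub acc c = desInvGo-mono (drop-∷-⊆ sub) (acc ∧ chain (suc c)) 0
desInvGo-mono {bs = false ∷ bs}  {true ∷ bs'}  sub acc c =
  desInvGo-mono (drop-∷-⊆ sub) (acc ∧ chain (suc c)) 0 ◅◅ desInvGo-merge bs' acc c 0
desInvGo-mono {bs = true ∷ bs}   {false ∷ bs'} sub acc c with sub here
... | ()

desInv-mono : {S S' : Subset m} → S ⊆ S' → desInv S ≤T desInv S'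
desInv-mono S⊆S' = desInvGo-mono S⊆S' leaf 0

desInv-fiber-minimum : (S : Subset m) (t : Tree) → size t ≡ suc m → des m t ≡ S → t ≤T desInv S → t ≡ desInv S
desInv-fiber-minimum S t sz d t≤S =
  avoids⇒minimal (desInv-avoids S) t≤S (des≡⇒desWord≡ sz (size-desInv S) (trans d (sym (des-desInv S))))

fiber-minimal⇒avoids : size u ≡ suc m →
  ((t : Tree) → size t ≡ suc m → des m t ≡ des m u → t ≤T u → t ≡ u) → ¬ Contains u comb₂¹
fiber-minimal⇒avoids {u} sz minimal contains with contains⇒left-rotation contains
... | t , ρ , w =
  RightRot-irrefl (subst (λ x → RightRot x u) (minimal t (trans (size-RightRot ρ) sz) (desWord≡⇒des≡ t u w) (ρ ◅ ε)) ρ)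

fiber-minimal⇒desInv : (S : Subset m) (u : Tree) → size u ≡ suc m → des m u ≡ S →
  ((t : Tree) → size t ≡ suc m → des m t ≡ S → t ≤T u → t ≡ u) → u ≡ desInv S
fiber-minimal⇒desInv S u sz d minimal
  with avoids⇒image sz (fiber-minimal⇒avoids sz λ t szt dt → minimal t szt (trans dt d))
... | S' , refl = cong desInv (trans (sym (des-desInv S')) d)

proposition3p4 : (m : ℕ) →
    ((S : Subset m) → size (desInv S) ≡ suc m
                      × multiDegree (Φ (desInv S)) ≡ desInvDegree S)
  × ((S S' : Subset m) → desInv S ≡ desInv S' → S ≡ S')
  × ((S S' : Subset m) → S ⊆ S' → desInv S ≤T desInv S')
  × ((S S' : Subset m) → desInv S ≤T desInv S' → S ⊆ S')
  × ((t : Tree) → size t ≡ suc m →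
       ((¬ Contains t comb₂¹) ⇔ Σ (Subset m) (λ S → desInv S ≡ t)))
  × ((S : Subset m) →
       des m (desInv S) ≡ S
     × ((t : Tree) → size t ≡ suc m → des m t ≡ S → t ≤T desInv S → t ≡ desInv S)
     × ((u : Tree) → size u ≡ suc m → des m u ≡ S →
          ((t : Tree) → size t ≡ suc m → des m t ≡ S → t ≤T u → t ≡ u) →
          u ≡ desInv S))
proposition3p4 m =
    (λ S → size-desInv S , multiDegree-desInv S)
  , (λ S S' eq → trans (sym (des-desInv S)) (trans (cong (des m) eq) (des-desInv S')))
  , (λ S S' → desInv-mono)
  , (λ S S' S≤S' → subst₂ _⊆_ (des-desInv S) (des-desInv S') (des-mono S≤S'))
  , (λ t sz → mk⇔ (avoids⇒image sz) λ { (S , refl) → desInv-avoids S })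
  , (λ S → des-desInv S , desInv-fiber-minimum S , fiber-minimal⇒desInv S)
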